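{- Let $\lambda$ be a nonzero real number. For every integer $n\ge0$, \[ (x)_n=\sum_{m=0}^{n}G_{m,\lambda}(x)\,S_{2,\lambda}(n,m), \] and, for $x=1$, $(1)_n=\sum_{m=0}^{n}G_{m,\lambda}S_{2,\lambda}(n,m)$.
   Context: $(x)_0=1$ and $(x)_n=x(x-1)\cdots(x-n+1)$ for $n\ge1$ (falling factorial). For a nonzero real $\lambda$, set $(x)_{0,\lambda}=1$ and $(x)_{n,\lambda}=x(x-\lambda)\cdots(x-(n-1)\lambda)$ for $n\ge1$. Let $e_\lambda^x(t)=\sum_{n\ge0}(x)_{n,\lambda}\frac{t^n}{n!}=(1+\lambda t)^{x/\lambda}$, $e_\lambda(t)=e_\lambda^1(t)$, and $\log_\lambda(1+t)=\frac{1}{\lambda}((1+t)^\lambda-1)$. The degenerate Stirling numbers of the second kind are defined by $\frac{1}{k!}(e_\lambda(t)-1)^k=\sum_{n\ge k}S_{2,\lambda}(n,k)\frac{t^n}{n!}$. The Gaenari polynomials are defined by $e_\lambda^x\big(\log_\lambda(\log_\lambda(1+t)+1)\big)=\sum_{n\ge0}G_{n,\lambda}(x)\frac{t^n}{n!}$, with $G_{n,\lambda}=G_{n,\lambda}(1)$. -}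

module Defs where

open import Level using (Level)
open import Data.Nat using (ℕ; zero; suc; _∸_)
open import Data.Nat.Combinatorics using (_C_)
open import Algebra.Bundles using (CommutativeRing)

-- All series below are exponential generating functions, represented by
-- their coefficient sequences: a : ℕ → R stands for Σ a n t^n/n!.

module WithRing {c ℓ : Level} (R : CommutativeRing c ℓ) where
  open CommutativeRing R

  Seq : Set c
  Seq = ℕ → Carrier

  _·_ : ℕ → Carrier → Carrier
  zero · a = 0#
  suc n · a = a + (n · a)

  sumTo : ℕ → (ℕ → Carrier) → Carrier
  sumTo zero f = f 0
  sumTo (suc n) f = sumTo n f + f (suc n)

  fallingλ : Carrier → Carrier → ℕ → Carrier
  fallingλ x lam zero = 1#
  fallingλ x lam (suc n) = fallingλ x lam n * (x - (n · lam))

  falling : Carrier → ℕ → Carrier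
  falling x n = fallingλ x 1# n

  δ : Seq
  δ zero = 1#
  δ (suc n) = 0#

  -- powDiv g k = g(t)^k / k!  (EGF coefficients), for g with g(0) = 0
  -- (the constant coefficient g 0 is never used), computed by the
  -- division-free recursion  d/dt (g^{k+1}/(k+1)!) = g'(t) · g^k/k!.
  powDiv : Seq → ℕ → Seq
  powDiv g zero = δ
  powDiv g (suc k) zero = 0#
  powDiv g (suc k) (suc n) =
    sumTo n (λ i → (n C i) · (g (suc i) * powDiv g k (n ∸ i)))

  comp : Seq → Seq → Seq
  comp f g n = sumTo n (λ k → f k * powDiv g k n)

  eλ^ : Carrier → Carrier → Seq
  eλ^ lam x = fallingλ x lam

  eλ-1 : Carrier → Seq
  eλ-1 lam n = eλ^ lam 1# n - δ n

  binom : Carrier → Seq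
  binom a = falling a

  logλ1+ : Carrier → Carrier → Seq
  logλ1+ lam lamInv n = lamInv * (binom lam n - δ n)

  S2λ : Carrier → ℕ → ℕ → Carrier
  S2λ lam n k = powDiv (eλ-1 lam) k n

  Gλ : Carrier → Carrier → Carrier → ℕ → Carrier
  Gλ lam lamInv x = comp (eλ^ lam x) (comp (logλ1+ lam lamInv) (logλ1+ lam lamInv))

-- With L = log_λ(1+t) and E = e_λ(t) − 1 one has
-- Σ_m G_{m,λ}(x) S_{2,λ}(n,m) = [tⁿ/n!] G_λ(x)(E(t)) and, by associativity of
-- composition, G_λ(x)∘E = e_λ^x ∘ L ∘ (L ∘ E).  Two identities finish the proof:
-- L ∘ E = t and e_λ^x ∘ L = (1+t)^x.  Both are proved without logarithms or
-- exponentials: each side satisfies the same first-order linear differential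
-- equation with the same constant term, e.g. (1+t)·y′ = x·y for e_λ^x ∘ L and
-- (1+t)^x, and such an equation determines its solution coefficientwise.

module Submission where

open import Defs
open import Level using (Level)
open import Data.Nat using (ℕ; zero; suc; _∸_; _≤_; _<_; z≤n; s≤s)
  renaming (_+_ to _+ℕ_)
open import Data.Nat.Properties using (≤-refl; ≤-trans; m≤n⇒m<n∨m≡n; m≤n⇒m≤1+n; +-∸-assoc)
open import Data.Nat.Combinatorics using (_C_; k>n⇒nCk≡0; nCk+nC[k+1]≡[n+1]C[k+1])
open import Data.Nat.Induction using (<-rec)
open import Data.Sum using (inj₁; inj₂)
open import Data.Product using (_×_; _,_)
import Relation.Binary.PropositionalEquality as ≡
open import Algebra.Bundles using (CommutativeRing)
import Algebra.Properties.Ring as RingProperties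
import Algebra.Solver.Ring.NaturalCoefficients.Default as NatCoefficientSolver
import Relation.Binary.Reasoning.Setoid as SetoidReasoning

module PowerSeries {c ℓ : Level} (R : CommutativeRing c ℓ) where
  open CommutativeRing R
  open WithRing R
  open RingProperties ring
    using (-0#≈0#; -‿distribˡ-*; -‿+-comm; x∙y⁻¹≈ε⇒x≈y; x≈y⇒x∙y⁻¹≈ε)
  open NatCoefficientSolver commutativeSemiring using (solve; _:=_; _:+_; _:*_)
  open SetoidReasoning setoid

  x-0#≈x : ∀ x → x - 0# ≈ x
  x-0#≈x x = trans (+-congˡ -0#≈0#) (+-identityʳ x)

  x+[y-x]≈y : ∀ x y → x + (y - x) ≈ y
  x+[y-x]≈y x y = begin
    x + (y - x)    ≈⟨ +-comm x (y - x) ⟩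
    y - x + x      ≈⟨ +-assoc y (- x) x ⟩
    y + (- x + x)  ≈⟨ +-congˡ (-‿inverseˡ x) ⟩
    y + 0#         ≈⟨ +-identityʳ y ⟩
    y              ∎

  ·-homo-+ : ∀ m k a → (m +ℕ k) · a ≈ m · a + k · a
  ·-homo-+ zero    k a = sym (+-identityˡ (k · a))
  ·-homo-+ (suc m) k a = trans (+-congˡ (·-homo-+ m k a)) (sym (+-assoc a (m · a) (k · a)))

  ·≈·1#* : ∀ m a → m · a ≈ (m · 1#) * a
  ·≈·1#* zero    a = sym (zeroˡ a)
  ·≈·1#* (suc m) a = begin
    a + m · a                ≈⟨ +-cong (sym (*-identityˡ a)) (·≈·1#* m a) ⟩
    1# * a + (m · 1#) * a    ≈⟨ distribʳ a 1# (m · 1#) ⟨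
    (1# + m · 1#) * a        ∎

  a[x-k·l]+l[k·a]≈xa : ∀ k a x l → a * (x - k · l) + l * (k · a) ≈ x * a
  a[x-k·l]+l[k·a]≈xa k a x l = begin
    a * (x - k · l) + l * (k · a)
      ≈⟨ +-cong (*-congˡ (+-congˡ (-‿cong (·≈·1#* k l)))) (*-congˡ (·≈·1#* k a)) ⟩
    a * (x - K * l) + l * (K * a)
      ≈⟨ solve 5 (λ a x m K l → a :* (x :+ m) :+ l :* (K :* a) := x :* a :+ a :* (m :+ K :* l))
               refl a x (- (K * l)) K l ⟩
    x * a + a * (- (K * l) + K * l)  ≈⟨ +-congˡ (trans (*-congˡ (-‿inverseˡ (K * l))) (zeroʳ a)) ⟩
    x * a + 0#                       ≈⟨ +-identityʳ (x * a) ⟩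
    x * a                            ∎
    where
    K : Carrier
    K = k · 1#

  sumTo-cong : ∀ n {F G : ℕ → Carrier} → (∀ k → k ≤ n → F k ≈ G k) → sumTo n F ≈ sumTo n G
  sumTo-cong zero    F≈G = F≈G 0 z≤n
  sumTo-cong (suc n) F≈G =
    +-cong (sumTo-cong n (λ k k≤n → F≈G k (m≤n⇒m≤1+n k≤n))) (F≈G (suc n) ≤-refl)

  sumTo-head : ∀ n (F : ℕ → Carrier) → sumTo (suc n) F ≈ F 0 + sumTo n (λ k → F (suc k))
  sumTo-head zero    F = refl
  sumTo-head (suc n) F = begin
    sumTo (suc n) F + F (suc (suc n))                      ≈⟨ +-congʳ (sumTo-head n F) ⟩
    F 0 + sumTo n (λ k → F (suc k)) + F (suc (suc n))      ≈⟨ +-assoc _ _ _ ⟩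
    F 0 + (sumTo n (λ k → F (suc k)) + F (suc (suc n)))    ∎

  sumTo-+ : ∀ n (F G : ℕ → Carrier) → sumTo n (λ k → F k + G k) ≈ sumTo n F + sumTo n G
  sumTo-+ zero    F G = refl
  sumTo-+ (suc n) F G = begin
    sumTo n (λ k → F k + G k) + (F (suc n) + G (suc n))  ≈⟨ +-congʳ (sumTo-+ n F G) ⟩
    sumTo n F + sumTo n G + (F (suc n) + G (suc n))
      ≈⟨ solve 4 (λ a b c d → (a :+ b) :+ (c :+ d) := (a :+ c) :+ (b :+ d)) refl _ _ _ _ ⟩
    sumTo n F + F (suc n) + (sumTo n G + G (suc n))      ∎

  sumTo-* : ∀ n a (F : ℕ → Carrier) → sumTo n (λ k → a * F k) ≈ a * sumTo n F
  sumTo-* zero    a F = refl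
  sumTo-* (suc n) a F = trans (+-congʳ (sumTo-* n a F)) (sym (distribˡ a _ _))

  sumTo-zero : ∀ n (F : ℕ → Carrier) → (∀ k → k ≤ n → F k ≈ 0#) → sumTo n F ≈ 0#
  sumTo-zero n F F≈0 = trans (sumTo-cong n F≈0) (zeros n)
    where
    zeros : ∀ n → sumTo n (λ _ → 0#) ≈ 0#
    zeros zero    = refl
    zeros (suc n) = trans (+-congʳ (zeros n)) (+-identityˡ 0#)

  sumTo-truncate : ∀ n j (F : ℕ → Carrier) → j ≤ n → (∀ k → j < k → F k ≈ 0#) →
                   sumTo n F ≈ sumTo j F
  sumTo-truncate n j F j≤n F≈0 with m≤n⇒m<n∨m≡n j≤n
  sumTo-truncate n       j F _ F≈0 | inj₂ ≡.refl         = refl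
  sumTo-truncate (suc n) j F _ F≈0 | inj₁ (s≤s j≤n) =
    trans (+-cong (sumTo-truncate n j F j≤n F≈0) (F≈0 (suc n) (s≤s j≤n))) (+-identityʳ _)

  -- Exponential generating functions

  infix  4 _≋_ _≋[_]_
  infixl 6 _⊕_
  infixl 7 _⊗_
  infixr 8 _⊙_
  infix  9 ⊖_ 1+_t

  _≋_ : Seq → Seq → Set ℓ
  f ≋ g = ∀ n → f n ≈ g n

  _≋[_]_ : Seq → ℕ → Seq → Set ℓ
  f ≋[ n ] g = ∀ j → j ≤ n → f j ≈ g j

  ∂ : Seq → Seq
  ∂ f n = f (suc n)

  _⊕_ : Seq → Seq → Seq
  (f ⊕ g) n = f n + g n

  ⊖_ : Seq → Seq
  (⊖ f) n = - f n

  _⊙_ : Carrier → Seq → Seq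
  (a ⊙ f) n = a * f n

  X : Seq
  X zero          = 0#
  X (suc zero)    = 1#
  X (suc (suc n)) = 0#

  1+_t : Carrier → Seq
  1+ l t = δ ⊕ l ⊙ X

  -- The product is defined by the Leibniz rule (ab)′ = a′b + ab′; it agrees with
  -- the binomial convolution of the coefficients (binomialConvolution≈⊗).
  _⊗_ : Seq → Seq → Seq
  (a ⊗ b) zero    = a 0 * b 0
  (a ⊗ b) (suc n) = (∂ a ⊗ b) n + (a ⊗ ∂ b) n

  ⊗-cong-≤ : ∀ n {a a′ b b′} → a ≋[ n ] a′ → b ≋[ n ] b′ → (a ⊗ b) n ≈ (a′ ⊗ b′) n
  ⊗-cong-≤ zero    a≈a′ b≈b′ = *-cong (a≈a′ 0 z≤n) (b≈b′ 0 z≤n)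
  ⊗-cong-≤ (suc n) a≈a′ b≈b′ = +-cong
    (⊗-cong-≤ n (λ j j≤n → a≈a′ (suc j) (s≤s j≤n)) (λ j j≤n → b≈b′ j (m≤n⇒m≤1+n j≤n)))
    (⊗-cong-≤ n (λ j j≤n → a≈a′ j (m≤n⇒m≤1+n j≤n)) (λ j j≤n → b≈b′ (suc j) (s≤s j≤n)))

  ⊗-cong : ∀ {a a′ b b′} → a ≋ a′ → b ≋ b′ → a ⊗ b ≋ a′ ⊗ b′
  ⊗-cong a≈a′ b≈b′ n = ⊗-cong-≤ n (λ j _ → a≈a′ j) (λ j _ → b≈b′ j)

  ⊗-congˡ : ∀ {a b b′} → b ≋ b′ → a ⊗ b ≋ a ⊗ b′
  ⊗-congˡ = ⊗-cong (λ _ → refl)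

  ⊗-congʳ : ∀ {a a′ b} → a ≋ a′ → a ⊗ b ≋ a′ ⊗ b
  ⊗-congʳ a≈a′ = ⊗-cong a≈a′ (λ _ → refl)

  ⊗-comm : ∀ a b → a ⊗ b ≋ b ⊗ a
  ⊗-comm a b zero    = *-comm (a 0) (b 0)
  ⊗-comm a b (suc n) = trans (+-cong (⊗-comm (∂ a) b n) (⊗-comm a (∂ b) n)) (+-comm _ _)

  ⊗-distribˡ : ∀ a b c → a ⊗ (b ⊕ c) ≋ a ⊗ b ⊕ a ⊗ c
  ⊗-distribˡ a b c zero    = distribˡ (a 0) (b 0) (c 0)
  ⊗-distribˡ a b c (suc n) = begin
    (∂ a ⊗ (b ⊕ c)) n + (a ⊗ (∂ b ⊕ ∂ c)) n
      ≈⟨ +-cong (⊗-distribˡ (∂ a) b c n) (⊗-distribˡ a (∂ b) (∂ c) n) ⟩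
    (∂ a ⊗ b) n + (∂ a ⊗ c) n + ((a ⊗ ∂ b) n + (a ⊗ ∂ c) n)
      ≈⟨ solve 4 (λ p q r s → (p :+ q) :+ (r :+ s) := (p :+ r) :+ (q :+ s)) refl _ _ _ _ ⟩
    (∂ a ⊗ b) n + (a ⊗ ∂ b) n + ((∂ a ⊗ c) n + (a ⊗ ∂ c) n)
      ∎

  ⊗-distribʳ : ∀ a b c → (a ⊕ b) ⊗ c ≋ a ⊗ c ⊕ b ⊗ c
  ⊗-distribʳ a b c n = begin
    ((a ⊕ b) ⊗ c) n              ≈⟨ ⊗-comm (a ⊕ b) c n ⟩
    (c ⊗ (a ⊕ b)) n              ≈⟨ ⊗-distribˡ c a b n ⟩
    (c ⊗ a) n + (c ⊗ b) n        ≈⟨ +-cong (⊗-comm c a n) (⊗-comm c b n) ⟩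
    (a ⊗ c) n + (b ⊗ c) n        ∎

  ⊗-⊙ʳ : ∀ a k b → a ⊗ (k ⊙ b) ≋ k ⊙ (a ⊗ b)
  ⊗-⊙ʳ a k b zero    = solve 3 (λ x k y → x :* (k :* y) := k :* (x :* y)) refl (a 0) k (b 0)
  ⊗-⊙ʳ a k b (suc n) =
    trans (+-cong (⊗-⊙ʳ (∂ a) k b n) (⊗-⊙ʳ a k (∂ b) n)) (sym (distribˡ k _ _))

  ⊗-⊙ˡ : ∀ k a b → (k ⊙ a) ⊗ b ≋ k ⊙ (a ⊗ b)
  ⊗-⊙ˡ k a b n =
    trans (⊗-comm (k ⊙ a) b n) (trans (⊗-⊙ʳ b k a n) (*-congˡ (⊗-comm b a n)))

  ⊗-negˡ : ∀ a b → (⊖ a) ⊗ b ≋ ⊖ (a ⊗ b)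
  ⊗-negˡ a b zero    = sym (-‿distribˡ-* (a 0) (b 0))
  ⊗-negˡ a b (suc n) = trans (+-cong (⊗-negˡ (∂ a) b n) (⊗-negˡ a (∂ b) n)) (-‿+-comm _ _)

  ⊗-zeroʳ-≤ : ∀ n a b → (∀ j → j ≤ n → b j ≈ 0#) → (a ⊗ b) n ≈ 0#
  ⊗-zeroʳ-≤ zero    a b b≈0 = trans (*-congˡ (b≈0 0 z≤n)) (zeroʳ (a 0))
  ⊗-zeroʳ-≤ (suc n) a b b≈0 = trans
    (+-cong (⊗-zeroʳ-≤ n (∂ a) b (λ j j≤n → b≈0 j (m≤n⇒m≤1+n j≤n)))
            (⊗-zeroʳ-≤ n a (∂ b) (λ j j≤n → b≈0 (suc j) (s≤s j≤n))))
    (+-identityˡ 0#)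

  ⊗-zeroˡ-≤ : ∀ n a b → (∀ j → j ≤ n → a j ≈ 0#) → (a ⊗ b) n ≈ 0#
  ⊗-zeroˡ-≤ n a b a≈0 = trans (⊗-comm a b n) (⊗-zeroʳ-≤ n b a a≈0)

  ⊗-assoc : ∀ a b c → (a ⊗ b) ⊗ c ≋ a ⊗ (b ⊗ c)
  ⊗-assoc a b c zero    = *-assoc (a 0) (b 0) (c 0)
  ⊗-assoc a b c (suc n) = begin
    (∂ (a ⊗ b) ⊗ c) n + ((a ⊗ b) ⊗ ∂ c) n
      ≈⟨ +-congʳ (⊗-distribʳ (∂ a ⊗ b) (a ⊗ ∂ b) c n) ⟩
    ((∂ a ⊗ b) ⊗ c) n + ((a ⊗ ∂ b) ⊗ c) n + ((a ⊗ b) ⊗ ∂ c) n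
      ≈⟨ +-cong (+-cong (⊗-assoc (∂ a) b c n) (⊗-assoc a (∂ b) c n)) (⊗-assoc a b (∂ c) n) ⟩
    (∂ a ⊗ (b ⊗ c)) n + (a ⊗ (∂ b ⊗ c)) n + (a ⊗ (b ⊗ ∂ c)) n
      ≈⟨ +-assoc _ _ _ ⟩
    (∂ a ⊗ (b ⊗ c)) n + ((a ⊗ (∂ b ⊗ c)) n + (a ⊗ (b ⊗ ∂ c)) n)
      ≈⟨ +-congˡ (⊗-distribˡ a (∂ b ⊗ c) (b ⊗ ∂ c) n) ⟨
    (∂ a ⊗ (b ⊗ c)) n + (a ⊗ ∂ (b ⊗ c)) n
      ∎

  ⊗-identityˡ : ∀ b → δ ⊗ b ≋ b
  ⊗-identityˡ b zero    = *-identityˡ (b 0)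
  ⊗-identityˡ b (suc n) =
    trans (+-cong (⊗-zeroˡ-≤ n (∂ δ) b (λ _ _ → refl)) (⊗-identityˡ (∂ b) n)) (+-identityˡ _)

  ⊗-identityʳ : ∀ b → b ⊗ δ ≋ b
  ⊗-identityʳ b n = trans (⊗-comm b δ n) (⊗-identityˡ b n)

  ∂X≋δ : ∂ X ≋ δ
  ∂X≋δ zero    = refl
  ∂X≋δ (suc n) = refl

  X⊗-suc : ∀ n b → (X ⊗ b) (suc n) ≈ suc n · b n
  X⊗-suc n b = +-cong (trans (⊗-congʳ ∂X≋δ n) (⊗-identityˡ b n)) (X⊗∂ n b)
    where
    X⊗∂ : ∀ n b → (X ⊗ ∂ b) n ≈ n · b n
    X⊗∂ zero    b = zeroˡ (b 1)
    X⊗∂ (suc n) b = X⊗-suc n (∂ b)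

  1+t-zero : ∀ l → (1+ l t) 0 ≈ 1#
  1+t-zero l = trans (+-congˡ (zeroʳ l)) (+-identityʳ 1#)

  ⊗-1+t-zero : ∀ a l → (a ⊗ 1+ l t) 0 ≈ a 0
  ⊗-1+t-zero a l = trans (*-congˡ (1+t-zero l)) (*-identityʳ (a 0))

  ⊗-1+t-suc : ∀ a l m → (a ⊗ 1+ l t) (suc m) ≈ a (suc m) + l * (suc m · a m)
  ⊗-1+t-suc a l m = begin
    (a ⊗ (δ ⊕ l ⊙ X)) (suc m)                ≈⟨ ⊗-distribˡ a δ (l ⊙ X) (suc m) ⟩
    (a ⊗ δ) (suc m) + (a ⊗ l ⊙ X) (suc m)
      ≈⟨ +-cong (⊗-identityʳ a (suc m)) (⊗-⊙ʳ a l X (suc m)) ⟩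
    a (suc m) + l * (a ⊗ X) (suc m)
      ≈⟨ +-congˡ (*-congˡ (trans (⊗-comm a X (suc m)) (X⊗-suc m a))) ⟩
    a (suc m) + l * (suc m · a m)            ∎

  ⊗-sumTo : ∀ m n a (F : ℕ → Seq) →
            (a ⊗ (λ j → sumTo m (λ k → F k j))) n ≈ sumTo m (λ k → (a ⊗ F k) n)
  ⊗-sumTo zero    n a F = refl
  ⊗-sumTo (suc m) n a F =
    trans (⊗-distribˡ a (λ j → sumTo m (λ k → F k j)) (F (suc m)) n) (+-congʳ (⊗-sumTo m n a F))

  ⊗-leading : ∀ n a b → (∀ j → j < n → a j ≈ 0#) → (a ⊗ b) n ≈ a n * b 0
  ⊗-leading zero    a b _   = refl
  ⊗-leading (suc n) a b a≈0 = begin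
    (∂ a ⊗ b) n + (a ⊗ ∂ b) n
      ≈⟨ +-cong (⊗-leading n (∂ a) b (λ j j<n → a≈0 (suc j) (s≤s j<n)))
                (⊗-zeroˡ-≤ n a (∂ b) (λ j j≤n → a≈0 j (s≤s j≤n))) ⟩
    a (suc n) * b 0 + 0#  ≈⟨ +-identityʳ _ ⟩
    a (suc n) * b 0       ∎

  -- A solution of y′·q = (a causal expression in y) with q(0) = 1 is determined
  -- by its constant term: the n-th equation fixes y(n+1) from y(0), …, y(n).
  ode-uniqueness : ∀ {W W′} q → q 0 ≈ 1# → W 0 ≈ W′ 0 →
                   (∀ n → W ≋[ n ] W′ → (∂ W ⊗ q) n ≈ (∂ W′ ⊗ q) n) → W ≋ W′
  ode-uniqueness {W} {W′} q q0≈1 W0≈W′0 ode n = agree n n ≤-refl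
    where
    agree : ∀ n → W ≋[ n ] W′
    agree zero    _ z≤n   = W0≈W′0
    agree (suc n) j j≤1+n with m≤n⇒m<n∨m≡n j≤1+n
    ... | inj₁ (s≤s j≤n) = agree n j j≤n
    ... | inj₂ ≡.refl    = x∙y⁻¹≈ε⇒x≈y (∂ W n) (∂ W′ n) (begin
      ∂ W n - ∂ W′ n                     ≈⟨ *-identityʳ _ ⟨
      (∂ W ⊕ ⊖ ∂ W′) n * 1#              ≈⟨ *-congˡ q0≈1 ⟨
      (∂ W ⊕ ⊖ ∂ W′) n * q 0             ≈⟨ ⊗-leading n (∂ W ⊕ ⊖ ∂ W′) q lower ⟨
      ((∂ W ⊕ ⊖ ∂ W′) ⊗ q) n             ≈⟨ ⊗-distribʳ (∂ W) (⊖ ∂ W′) q n ⟩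
      (∂ W ⊗ q) n + ((⊖ ∂ W′) ⊗ q) n     ≈⟨ +-congˡ (⊗-negˡ (∂ W′) q n) ⟩
      (∂ W ⊗ q) n - (∂ W′ ⊗ q) n         ≈⟨ x≈y⇒x∙y⁻¹≈ε (ode n (agree n)) ⟩
      0#                                 ∎)
      where
      lower : ∀ i → i < n → ∂ W i - ∂ W′ i ≈ 0#
      lower i i<n = x≈y⇒x∙y⁻¹≈ε (agree n (suc i) i<n)

  -- Divided powers and composition

  binomialConvolution : Seq → Seq → Seq
  binomialConvolution a b n = sumTo n (λ i → (n C i) · (a i * b (n ∸ i)))

  binomialConvolution-suc : ∀ n a b → binomialConvolution a b (suc n) ≈
                            binomialConvolution (∂ a) b n + binomialConvolution a (∂ b) n
  binomialConvolution-suc n a b = begin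
    sumTo (suc n) F                                  ≈⟨ sumTo-head n F ⟩
    F 0 + sumTo n (λ i → F (suc i))
      ≈⟨ +-congˡ (trans (sumTo-cong n (λ i _ → pascal i)) (sumTo-+ n _ _)) ⟩
    F 0 + (binomialConvolution (∂ a) b n + sumTo n (λ i → H (suc i)))
      ≈⟨ solve 3 (λ p q r → p :+ (q :+ r) := q :+ (p :+ r)) refl _ _ _ ⟩
    binomialConvolution (∂ a) b n + (H 0 + sumTo n (λ i → H (suc i)))
      ≈⟨ +-congˡ (sumTo-head n H) ⟨
    binomialConvolution (∂ a) b n + sumTo (suc n) H  ≈⟨ +-congˡ lastVanishes ⟩
    binomialConvolution (∂ a) b n + sumTo n H        ≈⟨ +-congˡ (sumTo-cong n shift) ⟩
    binomialConvolution (∂ a) b n + binomialConvolution a (∂ b) n ∎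
    where
    F H : ℕ → Carrier
    F i = (suc n C i) · (a i * b (suc n ∸ i))
    H i = (n C i) · (a i * b (suc n ∸ i))
    pascal : ∀ i → F (suc i) ≈ (n C i) · (a (suc i) * b (n ∸ i)) + H (suc i)
    pascal i rewrite ≡.sym (nCk+nC[k+1]≡[n+1]C[k+1] n i) = ·-homo-+ (n C i) (n C suc i) _
    lastVanishes : sumTo (suc n) H ≈ sumTo n H
    lastVanishes rewrite k>n⇒nCk≡0 {n} {suc n} ≤-refl = +-identityʳ _
    shift : ∀ i → i ≤ n → H i ≈ (n C i) · (a i * ∂ b (n ∸ i))
    shift i i≤n rewrite +-∸-assoc 1 i≤n = refl

  binomialConvolution≈⊗ : ∀ n a b → binomialConvolution a b n ≈ (a ⊗ b) n
  binomialConvolution≈⊗ zero    a b = +-identityʳ _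
  binomialConvolution≈⊗ (suc n) a b = trans (binomialConvolution-suc n a b)
    (+-cong (binomialConvolution≈⊗ n (∂ a) b) (binomialConvolution≈⊗ n a (∂ b)))

  powDiv-suc : ∀ g k n → powDiv g (suc k) (suc n) ≈ (∂ g ⊗ powDiv g k) n
  powDiv-suc g k n = binomialConvolution≈⊗ n (∂ g) (powDiv g k)

  powDiv-vanishes : ∀ g k j → j < k → powDiv g k j ≈ 0#
  powDiv-vanishes g (suc k) zero    _         = refl
  powDiv-vanishes g (suc k) (suc j) (s≤s j<k) = trans (powDiv-suc g k j)
    (⊗-zeroʳ-≤ j (∂ g) (powDiv g k) (λ i i≤j → powDiv-vanishes g k i (≤-trans (s≤s i≤j) j<k)))

  powDiv-cong : ∀ {g g′} → g ≋ g′ → ∀ k → powDiv g k ≋ powDiv g′ k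
  powDiv-cong g≈g′ zero    n       = refl
  powDiv-cong g≈g′ (suc k) zero    = refl
  powDiv-cong {g} {g′} g≈g′ (suc k) (suc n) = begin
    powDiv g (suc k) (suc n)    ≈⟨ powDiv-suc g k n ⟩
    (∂ g ⊗ powDiv g k) n        ≈⟨ ⊗-cong (λ j → g≈g′ (suc j)) (powDiv-cong g≈g′ k) n ⟩
    (∂ g′ ⊗ powDiv g′ k) n      ≈⟨ powDiv-suc g′ k n ⟨
    powDiv g′ (suc k) (suc n)   ∎

  comp-zero : ∀ f g → comp f g 0 ≈ f 0
  comp-zero f g = *-identityʳ (f 0)

  comp-cong-≤ : ∀ n {f f′} g → f ≋[ n ] f′ → comp f g n ≈ comp f′ g n
  comp-cong-≤ n g f≈f′ = sumTo-cong n (λ k k≤n → *-congʳ (f≈f′ k k≤n))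

  comp-congˡ : ∀ {f f′} g → f ≋ f′ → comp f g ≋ comp f′ g
  comp-congˡ g f≈f′ n = comp-cong-≤ n g (λ j _ → f≈f′ j)

  comp-congʳ : ∀ f {g g′} → g ≋ g′ → comp f g ≋ comp f g′
  comp-congʳ f g≈g′ n = sumTo-cong n (λ k _ → *-congˡ (powDiv-cong g≈g′ k n))

  comp-⊕ : ∀ f f′ g → comp (f ⊕ f′) g ≋ comp f g ⊕ comp f′ g
  comp-⊕ f f′ g n = trans (sumTo-cong n (λ k _ → distribʳ _ _ _)) (sumTo-+ n _ _)

  comp-⊙ : ∀ a f g → comp (a ⊙ f) g ≋ a ⊙ comp f g
  comp-⊙ a f g n = trans (sumTo-cong n (λ k _ → *-assoc _ _ _)) (sumTo-* n a _)

  comp-δ : ∀ g → comp δ g ≋ δ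
  comp-δ g zero    = *-identityʳ 1#
  comp-δ g (suc n) = begin
    comp δ g (suc n)                                            ≈⟨ sumTo-head n _ ⟩
    1# * 0# + sumTo n (λ k → 0# * powDiv g (suc k) (suc n))
      ≈⟨ +-cong (zeroʳ 1#) (sumTo-zero n _ (λ k _ → zeroˡ _)) ⟩
    0# + 0#                                                     ≈⟨ +-identityˡ 0# ⟩
    0#                                                          ∎

  -- powDiv ignores the constant term of g, so the chain rule needs no hypothesis g 0 ≈ 0.
  comp-∂ : ∀ f g n → comp f g (suc n) ≈ (∂ g ⊗ comp (∂ f) g) n
  comp-∂ f g n = begin
    comp f g (suc n)                                                   ≈⟨ sumTo-head n _ ⟩
    f 0 * 0# + sumTo n (λ k → f (suc k) * powDiv g (suc k) (suc n))
      ≈⟨ +-cong (zeroʳ (f 0)) (sumTo-cong n (λ k _ → term k)) ⟩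
    0# + sumTo n (λ k → (∂ g ⊗ f (suc k) ⊙ powDiv g k) n)             ≈⟨ +-identityˡ _ ⟩
    sumTo n (λ k → (∂ g ⊗ f (suc k) ⊙ powDiv g k) n)
      ≈⟨ ⊗-sumTo n n (∂ g) (λ k → f (suc k) ⊙ powDiv g k) ⟨
    (∂ g ⊗ (λ j → sumTo n (λ k → f (suc k) * powDiv g k j))) n
      ≈⟨ ⊗-cong-≤ n (λ _ _ → refl) truncate ⟩
    (∂ g ⊗ comp (∂ f) g) n                                             ∎
    where
    term : ∀ k → f (suc k) * powDiv g (suc k) (suc n) ≈ (∂ g ⊗ f (suc k) ⊙ powDiv g k) n
    term k = trans (*-congˡ (powDiv-suc g k n)) (sym (⊗-⊙ʳ (∂ g) (f (suc k)) (powDiv g k) n))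
    truncate : (λ j → sumTo n (λ k → f (suc k) * powDiv g k j)) ≋[ n ] comp (∂ f) g
    truncate j j≤n = sumTo-truncate n j _ j≤n
      (λ k j<k → trans (*-congˡ (powDiv-vanishes g k j j<k)) (zeroʳ _))

  comp-X : ∀ g → g 0 ≈ 0# → comp X g ≋ g
  comp-X g g0≈0 zero    = trans (zeroˡ _) (sym g0≈0)
  comp-X g g0≈0 (suc n) = begin
    comp X g (suc n)               ≈⟨ comp-∂ X g n ⟩
    (∂ g ⊗ comp (∂ X) g) n         ≈⟨ ⊗-congˡ (λ j → trans (comp-congˡ g ∂X≋δ j) (comp-δ g j)) n ⟩
    (∂ g ⊗ δ) n                    ≈⟨ ⊗-identityʳ (∂ g) n ⟩
    g (suc n)                      ∎

  comp-Xʳ : ∀ f → comp f X ≋ f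
  comp-Xʳ f zero    = comp-zero f X
  comp-Xʳ f (suc n) = begin
    comp f X (suc n)               ≈⟨ comp-∂ f X n ⟩
    (∂ X ⊗ comp (∂ f) X) n         ≈⟨ ⊗-congʳ ∂X≋δ n ⟩
    (δ ⊗ comp (∂ f) X) n           ≈⟨ ⊗-identityˡ _ n ⟩
    comp (∂ f) X n                 ≈⟨ comp-Xʳ (∂ f) n ⟩
    f (suc n)                      ∎

  comp-1+t : ∀ l g → g 0 ≈ 0# → comp (1+ l t) g ≋ δ ⊕ l ⊙ g
  comp-1+t l g g0≈0 n = trans (comp-⊕ δ (l ⊙ X) g n)
    (+-cong (comp-δ g n) (trans (comp-⊙ l X g n) (*-congˡ (comp-X g g0≈0 n))))

  comp-⊗ : ∀ g n a b → comp (a ⊗ b) g n ≈ (comp a g ⊗ comp b g) n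
  comp-⊗ g = <-rec _ step
    where
    step : ∀ n → (∀ {j} → j < n → ∀ a b → comp (a ⊗ b) g j ≈ (comp a g ⊗ comp b g) j) →
           ∀ a b → comp (a ⊗ b) g n ≈ (comp a g ⊗ comp b g) n
    step zero    _  a b = trans (comp-zero (a ⊗ b) g) (sym (*-cong (comp-zero a g) (comp-zero b g)))
    step (suc n) ih a b = begin
      comp (a ⊗ b) g (suc n)
        ≈⟨ comp-∂ (a ⊗ b) g n ⟩
      (∂ g ⊗ comp (∂ a ⊗ b ⊕ a ⊗ ∂ b) g) n
        ≈⟨ ⊗-cong-≤ n (λ _ _ → refl) (λ j j≤n → trans (comp-⊕ (∂ a ⊗ b) (a ⊗ ∂ b) g j)
             (+-cong (ih (s≤s j≤n) (∂ a) b) (ih (s≤s j≤n) a (∂ b)))) ⟩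
      (∂ g ⊗ (comp (∂ a) g ⊗ comp b g ⊕ comp a g ⊗ comp (∂ b) g)) n
        ≈⟨ ⊗-distribˡ (∂ g) _ _ n ⟩
      (∂ g ⊗ (comp (∂ a) g ⊗ comp b g)) n + (∂ g ⊗ (comp a g ⊗ comp (∂ b) g)) n
        ≈⟨ +-cong (sym (⊗-assoc (∂ g) _ _ n))
             (trans (sym (⊗-assoc (∂ g) _ _ n)) (trans (⊗-congʳ (⊗-comm (∂ g) (comp a g)) n)
               (⊗-assoc (comp a g) (∂ g) _ n))) ⟩
      ((∂ g ⊗ comp (∂ a) g) ⊗ comp b g) n + (comp a g ⊗ (∂ g ⊗ comp (∂ b) g)) n
        ≈⟨ +-cong (⊗-congʳ (λ j → sym (comp-∂ a g j)) n) (⊗-congˡ (λ j → sym (comp-∂ b g j)) n) ⟩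
      (comp a g ⊗ comp b g) (suc n)
        ∎

  comp-assoc : ∀ g h n f → comp (comp f g) h n ≈ comp f (comp g h) n
  comp-assoc g h = <-rec _ step
    where
    step : ∀ n → (∀ {j} → j < n → ∀ f → comp (comp f g) h j ≈ comp f (comp g h) j) →
           ∀ f → comp (comp f g) h n ≈ comp f (comp g h) n
    step zero    _  f = trans (comp-zero (comp f g) h) (trans (comp-zero f g) (sym (comp-zero f (comp g h))))
    step (suc n) ih f = begin
      comp (comp f g) h (suc n)                                    ≈⟨ comp-∂ (comp f g) h n ⟩
      (∂ h ⊗ comp (∂ (comp f g)) h) n
        ≈⟨ ⊗-congˡ (λ j → trans (comp-congˡ h (comp-∂ f g) j) (comp-⊗ h j (∂ g) (comp (∂ f) g))) n ⟩
      (∂ h ⊗ (comp (∂ g) h ⊗ comp (comp (∂ f) g) h)) n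
        ≈⟨ ⊗-cong-≤ n (λ _ _ → refl) (λ j j≤n → ⊗-cong-≤ j (λ _ _ → refl)
             (λ i i≤j → ih (s≤s (≤-trans i≤j j≤n)) (∂ f))) ⟩
      (∂ h ⊗ (comp (∂ g) h ⊗ comp (∂ f) (comp g h))) n             ≈⟨ ⊗-assoc _ _ _ n ⟨
      ((∂ h ⊗ comp (∂ g) h) ⊗ comp (∂ f) (comp g h)) n
        ≈⟨ ⊗-congʳ (λ j → sym (comp-∂ g h j)) n ⟩
      (∂ (comp g h) ⊗ comp (∂ f) (comp g h)) n                     ≈⟨ comp-∂ f (comp g h) n ⟨
      comp f (comp g h) (suc n)                                    ∎

  -- Differential equations of the degenerate exponentials and logarithm

  fallingλ-ode : ∀ x l → ∂ (fallingλ x l) ⊗ 1+ l t ≋ x ⊙ fallingλ x l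
  fallingλ-ode x l zero = begin
    (∂ (fallingλ x l) ⊗ 1+ l t) 0   ≈⟨ ⊗-1+t-zero (∂ (fallingλ x l)) l ⟩
    1# * (x - 0#)                   ≈⟨ trans (*-identityˡ _) (x-0#≈x x) ⟩
    x                               ≈⟨ *-identityʳ x ⟨
    x * 1#                          ∎
  fallingλ-ode x l (suc m) =
    trans (⊗-1+t-suc (∂ (fallingλ x l)) l m) (a[x-k·l]+l[k·a]≈xa (suc m) _ x l)

  module Degenerate (lam lamInv : Carrier) (lam*lamInv≈1 : lam * lamInv ≈ 1#) where

    L E : Seq
    L = logλ1+ lam lamInv
    E = eλ-1 lam

    L0≈0 : L 0 ≈ 0#
    L0≈0 = trans (*-congˡ (-‿inverseʳ 1#)) (zeroʳ lamInv)

    E0≈0 : E 0 ≈ 0#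
    E0≈0 = -‿inverseʳ 1#

    lam[lamInv*y]≈y : ∀ y → lam * (lamInv * y) ≈ y
    lam[lamInv*y]≈y y =
      trans (sym (*-assoc lam lamInv y)) (trans (*-congʳ lam*lamInv≈1) (*-identityˡ y))

    lamInv[lam*y]≈y : ∀ y → lamInv * (lam * y) ≈ y
    lamInv[lam*y]≈y y = trans (sym (*-assoc lamInv lam y))
      (trans (*-congʳ (trans (*-comm lamInv lam) lam*lamInv≈1)) (*-identityˡ y))

    logλ-ode : ∂ L ⊗ 1+ 1# t ≋ δ ⊕ lam ⊙ L
    logλ-ode n = begin
      (∂ L ⊗ 1+ 1# t) n                 ≈⟨ ⊗-congʳ (λ j → *-congˡ (x-0#≈x _)) n ⟩
      ((lamInv ⊙ ∂ B) ⊗ 1+ 1# t) n      ≈⟨ ⊗-⊙ˡ lamInv (∂ B) (1+ 1# t) n ⟩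
      lamInv * (∂ B ⊗ 1+ 1# t) n        ≈⟨ *-congˡ (fallingλ-ode lam 1# n) ⟩
      lamInv * (lam * B n)              ≈⟨ lamInv[lam*y]≈y (B n) ⟩
      B n                               ≈⟨ x+[y-x]≈y (δ n) (B n) ⟨
      δ n + (B n - δ n)                 ≈⟨ +-congˡ (lam[lamInv*y]≈y _) ⟨
      δ n + lam * L n                   ∎
      where
      B : Seq
      B = binom lam

    eλ-1-ode : ∂ E ⊗ 1+ lam t ≋ δ ⊕ E
    eλ-1-ode n = begin
      (∂ E ⊗ 1+ lam t) n                ≈⟨ ⊗-congʳ (λ j → x-0#≈x _) n ⟩
      (∂ A ⊗ 1+ lam t) n                ≈⟨ fallingλ-ode 1# lam n ⟩
      1# * A n                          ≈⟨ *-identityˡ (A n) ⟩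
      A n                               ≈⟨ x+[y-x]≈y (δ n) (A n) ⟨
      δ n + E n                         ∎
      where
      A : Seq
      A = eλ^ lam 1#

    eλ^∘logλ≋falling : ∀ x → comp (eλ^ lam x) L ≋ falling x
    eλ^∘logλ≋falling x = ode-uniqueness (1+ 1# t) (1+t-zero 1#) (comp-zero A L) ode
      where
      A C : Seq
      A = eλ^ lam x
      C = comp A L
      ∂C-ode : ∂ C ⊗ 1+ 1# t ≋ x ⊙ C
      ∂C-ode n = begin
        (∂ C ⊗ 1+ 1# t) n                          ≈⟨ ⊗-congʳ (comp-∂ A L) n ⟩
        ((∂ L ⊗ comp (∂ A) L) ⊗ 1+ 1# t) n         ≈⟨ ⊗-congʳ (⊗-comm (∂ L) _) n ⟩
        ((comp (∂ A) L ⊗ ∂ L) ⊗ 1+ 1# t) n         ≈⟨ ⊗-assoc _ _ _ n ⟩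
        (comp (∂ A) L ⊗ (∂ L ⊗ 1+ 1# t)) n
          ≈⟨ ⊗-congˡ (λ j → trans (logλ-ode j) (sym (comp-1+t lam L L0≈0 j))) n ⟩
        (comp (∂ A) L ⊗ comp (1+ lam t) L) n       ≈⟨ comp-⊗ L n (∂ A) (1+ lam t) ⟨
        comp (∂ A ⊗ 1+ lam t) L n                  ≈⟨ comp-congˡ L (fallingλ-ode x lam) n ⟩
        comp (x ⊙ A) L n                           ≈⟨ comp-⊙ x A L n ⟩
        x * C n                                    ∎
      ode : ∀ n → C ≋[ n ] falling x → (∂ C ⊗ 1+ 1# t) n ≈ (∂ (falling x) ⊗ 1+ 1# t) n
      ode n C≈B = trans (∂C-ode n) (trans (*-congˡ (C≈B n ≤-refl)) (sym (fallingλ-ode x 1# n)))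

    logλ∘eλ-1≋X : comp L E ≋ X
    logλ∘eλ-1≋X = ode-uniqueness q q0≈1 (trans (comp-zero L E) L0≈0) ode
      where
      W q : Seq
      W = comp L E
      q = (δ ⊕ E) ⊗ 1+ lam t
      q0≈1 : q 0 ≈ 1#
      q0≈1 = trans (⊗-1+t-zero (δ ⊕ E) lam) (trans (+-congˡ E0≈0) (+-identityʳ 1#))
      rearrange : ∀ a b c d → (a ⊗ b) ⊗ (c ⊗ d) ≋ (b ⊗ c) ⊗ (a ⊗ d)
      rearrange a b c d n = begin
        ((a ⊗ b) ⊗ (c ⊗ d)) n   ≈⟨ ⊗-congʳ (⊗-comm a b) n ⟩
        ((b ⊗ a) ⊗ (c ⊗ d)) n   ≈⟨ ⊗-assoc b a (c ⊗ d) n ⟩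
        (b ⊗ (a ⊗ (c ⊗ d))) n
          ≈⟨ ⊗-congˡ (λ j → trans (sym (⊗-assoc a c d j))
               (trans (⊗-congʳ (⊗-comm a c) j) (⊗-assoc c a d j))) n ⟩
        (b ⊗ (c ⊗ (a ⊗ d))) n   ≈⟨ ⊗-assoc b c (a ⊗ d) n ⟨
        ((b ⊗ c) ⊗ (a ⊗ d)) n   ∎
      ∂W-ode : ∂ W ⊗ q ≋ (δ ⊕ lam ⊙ W) ⊗ (δ ⊕ E)
      ∂W-ode n = begin
        (∂ W ⊗ q) n                                     ≈⟨ ⊗-congʳ (comp-∂ L E) n ⟩
        ((∂ E ⊗ comp (∂ L) E) ⊗ q) n                    ≈⟨ rearrange (∂ E) _ _ _ n ⟩
        ((comp (∂ L) E ⊗ (δ ⊕ E)) ⊗ (∂ E ⊗ 1+ lam t)) n ≈⟨ ⊗-cong outer eλ-1-ode n ⟩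
        ((δ ⊕ lam ⊙ W) ⊗ (δ ⊕ E)) n                     ∎
        where
        outer : comp (∂ L) E ⊗ (δ ⊕ E) ≋ δ ⊕ lam ⊙ W
        outer j = begin
          (comp (∂ L) E ⊗ (δ ⊕ E)) j
            ≈⟨ ⊗-congˡ (λ i → trans (comp-1+t 1# E E0≈0 i) (+-congˡ (*-identityˡ _))) j ⟨
          (comp (∂ L) E ⊗ comp (1+ 1# t) E) j       ≈⟨ comp-⊗ E j (∂ L) (1+ 1# t) ⟨
          comp (∂ L ⊗ 1+ 1# t) E j                  ≈⟨ comp-congˡ E logλ-ode j ⟩
          comp (δ ⊕ lam ⊙ L) E j                    ≈⟨ comp-⊕ δ (lam ⊙ L) E j ⟩
          comp δ E j + comp (lam ⊙ L) E j           ≈⟨ +-cong (comp-δ E j) (comp-⊙ lam L E j) ⟩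
          (δ ⊕ lam ⊙ W) j                           ∎
      ode : ∀ n → W ≋[ n ] X → (∂ W ⊗ q) n ≈ (∂ X ⊗ q) n
      ode n W≈X = begin
        (∂ W ⊗ q) n                    ≈⟨ ∂W-ode n ⟩
        ((δ ⊕ lam ⊙ W) ⊗ (δ ⊕ E)) n
          ≈⟨ ⊗-cong-≤ n (λ j j≤n → +-congˡ (*-congˡ (W≈X j j≤n))) (λ _ _ → refl) ⟩
        (1+ lam t ⊗ (δ ⊕ E)) n         ≈⟨ ⊗-comm _ _ n ⟩
        q n                            ≈⟨ ⊗-identityˡ q n ⟨
        (δ ⊗ q) n                      ≈⟨ ⊗-congʳ ∂X≋δ n ⟨
        (∂ X ⊗ q) n                    ∎

    falling≈ΣGλS2λ : ∀ x n → falling x n ≈ sumTo n (λ m → Gλ lam lamInv x m * S2λ lam n m)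
    falling≈ΣGλS2λ x n = sym (begin
      comp (comp (eλ^ lam x) (comp L L)) E n     ≈⟨ comp-assoc (comp L L) E n (eλ^ lam x) ⟩
      comp (eλ^ lam x) (comp (comp L L) E) n     ≈⟨ comp-congʳ (eλ^ lam x) LLE≋L n ⟩
      comp (eλ^ lam x) L n                       ≈⟨ eλ^∘logλ≋falling x n ⟩
      falling x n                                ∎)
      where
      LLE≋L : comp (comp L L) E ≋ L
      LLE≋L j = begin
        comp (comp L L) E j   ≈⟨ comp-assoc L E j L ⟩
        comp L (comp L E) j   ≈⟨ comp-congʳ L logλ∘eλ-1≋X j ⟩
        comp L X j            ≈⟨ comp-Xʳ L j ⟩
        L j                   ∎

theorem12 : ∀ {c ℓ} (R : CommutativeRing c ℓ) →
    let open CommutativeRing R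
        open WithRing R
    in (lam lamInv : Carrier) → lam * lamInv ≈ 1# →
       ((x : Carrier) (n : ℕ) →
          falling x n ≈ sumTo n (λ m → Gλ lam lamInv x m * S2λ lam n m))
       × ((n : ℕ) →
          falling 1# n ≈ sumTo n (λ m → Gλ lam lamInv 1# m * S2λ lam n m))
theorem12 R lam lamInv lam*lamInv≈1 = falling≈ΣGλS2λ , falling≈ΣGλS2λ (CommutativeRing.1# R)
  where open PowerSeries.Degenerate R lam lamInv lam*lamInv≈1
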